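{- Every graph that contains neither co-$2C_4$ nor $P_4$ as an induced subgraph is module-composed.
   Context: All graphs are finite, simple and undirected. For a graph $G=(V_G,E_G)$ and $v\in V_G$, $N(v)=\{w\in V_G : \{v,w\}\in E_G\}$. A set $M\subseteq V_G$ is a module of $G$ if for all $v_1,v_2\in M$ we have $N(v_1)\setminus M=N(v_2)\setminus M$ (in particular the empty set, singletons and $V_G$ are modules). For $U\subseteq V_G$, $G[U]$ is the induced subgraph on $U$. A graph $G$ is module-composed if there is a bijection $\varphi:V_G\to\{1,\ldots,|V_G|\}$ such that for every $2\le i\le |V_G|$ the neighbourhood of $\varphi^{ -1}(i)$ in the graph $G[\{\varphi^{ -1}(1),\ldots,\varphi^{ -1}(i-1)\}]$ is a module of that graph. $P_4$ is the path on four vertices; co-$2C_4$ is the complement of the disjoint union of two 4-cycles. -}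

module Defs where

open import Data.Nat using (ℕ; _<_)
open import Data.Fin using (Fin; toℕ)
open import Data.Fin.Patterns using (0F; 1F; 2F; 3F; 4F; 5F; 6F; 7F)
open import Data.Bool using (Bool; true; false; not; _∧_; _∨_)
open import Data.Product using (Σ; _×_)
open import Function.Definitions using (Injective)
open import Data.Fin.Permutation using (Permutation′; _⟨$⟩ʳ_)
open import Relation.Binary.PropositionalEquality using (_≡_)

record Graph : Set where
  field
    n      : ℕ
    adj    : Fin n → Fin n → Bool
    sym    : ∀ x y → adj x y ≡ adj y x
    irrefl : ∀ x → adj x x ≡ false
open Graph public

InducedSubgraph : Graph → Graph → Set
InducedSubgraph H G =
  Σ (Fin (n H) → Fin (n G)) λ f →
    Injective _≡_ _≡_ f × (∀ x y → adj G (f x) (f y) ≡ adj H x y)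

Free : Graph → Graph → Set
Free H G = InducedSubgraph H G → ⊥′
  where open import Data.Empty renaming (⊥ to ⊥′)

P4adj : Fin 4 → Fin 4 → Bool
P4adj 0F 1F = true
P4adj 1F 0F = true
P4adj 1F 2F = true
P4adj 2F 1F = true
P4adj 2F 3F = true
P4adj 3F 2F = true
P4adj _  _  = false

P4 : Graph
P4 = record
  { n = 4 ; adj = P4adj
  ; sym = λ { 0F 0F → refl′ ; 0F 1F → refl′ ; 0F 2F → refl′ ; 0F 3F → refl′
            ; 1F 0F → refl′ ; 1F 1F → refl′ ; 1F 2F → refl′ ; 1F 3F → refl′
            ; 2F 0F → refl′ ; 2F 1F → refl′ ; 2F 2F → refl′ ; 2F 3F → refl′
            ; 3F 0F → refl′ ; 3F 1F → refl′ ; 3F 2F → refl′ ; 3F 3F → refl′ }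
  ; irrefl = λ { 0F → refl′ ; 1F → refl′ ; 2F → refl′ ; 3F → refl′ }
  }
  where open import Relation.Binary.PropositionalEquality using () renaming (refl to refl′)

C4adj : Fin 4 → Fin 4 → Bool
C4adj 0F 1F = true
C4adj 1F 0F = true
C4adj 1F 2F = true
C4adj 2F 1F = true
C4adj 2F 3F = true
C4adj 3F 2F = true
C4adj 3F 0F = true
C4adj 0F 3F = true
C4adj _  _  = false

-- vertex x of Fin 8 lies in cycle (x < 4 ? 0 : 1) at position x mod 4
cyc : Fin 8 → Bool
cyc x = Data.Nat._<ᵇ_ 3 (toℕ x)
  where import Data.Nat

pos : Fin 8 → Fin 4
pos 0F = 0F
pos 1F = 1F
pos 2F = 2F
pos 3F = 3F
pos 4F = 0F
pos 5F = 1F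
pos 6F = 2F
pos 7F = 3F

sameCyc : Fin 8 → Fin 8 → Bool
sameCyc x y = not (Data.Bool._xor_ (cyc x) (cyc y))
  where import Data.Bool

twoC4adj : Fin 8 → Fin 8 → Bool
twoC4adj x y = sameCyc x y ∧ C4adj (pos x) (pos y)

coTwoC4adj : Fin 8 → Fin 8 → Bool
coTwoC4adj x y = not (Data.Nat._≡ᵇ_ (toℕ x) (toℕ y)) ∧ not (twoC4adj x y)
  where import Data.Nat

coTwoC4 : Graph
coTwoC4 = record
  { n = 8 ; adj = coTwoC4adj
  ; sym = λ { 0F 0F → refl′ ; 0F 1F → refl′ ; 0F 2F → refl′ ; 0F 3F → refl′ ; 0F 4F → refl′ ; 0F 5F → refl′ ; 0F 6F → refl′ ; 0F 7F → refl′ ; 1F 0F → refl′ ; 1F 1F → refl′ ; 1F 2F → refl′ ; 1F 3F → refl′ ; 1F 4F → refl′ ; 1F 5F → refl′ ; 1F 6F → refl′ ; 1F 7F → refl′ ; 2F 0F → refl′ ; 2F 1F → refl′ ; 2F 2F → refl′ ; 2F 3F → refl′ ; 2F 4F → refl′ ; 2F 5F → refl′ ; 2F 6F → refl′ ; 2F 7F → refl′ ; 3F 0F → refl′ ; 3F 1F → refl′ ; 3F 2F → refl′ ; 3F 3F → refl′ ; 3F 4F → refl′ ; 3F 5F → refl′ ; 3F 6F → refl′ ; 3F 7F → refl′ ; 4F 0F → refl′ ; 4F 1F → refl′ ; 4F 2F → refl′ ; 4F 3F → refl′ ; 4F 4F → refl′ ; 4F 5F → refl′ ; 4F 6F → refl′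 ; 4F 7F → refl′ ; 5F 0F → refl′ ; 5F 1F → refl′ ; 5F 2F → refl′ ; 5F 3F → refl′ ; 5F 4F → refl′ ; 5F 5F → refl′ ; 5F 6F → refl′ ; 5F 7F → refl′ ; 6F 0F → refl′ ; 6F 1F → refl′ ; 6F 2F → refl′ ; 6F 3F → refl′ ; 6F 4F → refl′ ; 6F 5F → refl′ ; 6F 6F → refl′ ; 6F 7F → refl′ ; 7F 0F → refl′ ; 7F 1F → refl′ ; 7F 2F → refl′ ; 7F 3F → refl′ ; 7F 4F → refl′ ; 7F 5F → refl′ ; 7F 6F → refl′ ; 7F 7F → refl′ }
  ; irrefl = λ { 0F → refl′ ; 1F → refl′ ; 2F → refl′ ; 3F → refl′ ; 4F → refl′ ; 5F → refl′ ; 6F → refl′ ; 7F → refl′ }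
  }
  where open import Relation.Binary.PropositionalEquality using () renaming (refl to refl′)

IsModuleIn : (G : Graph) → (S M : Fin (n G) → Bool) → Set
IsModuleIn G S M =
  ∀ v₁ v₂ w → M v₁ ≡ true → M v₂ ≡ true → S w ≡ true → M w ≡ false →
    adj G v₁ w ≡ adj G v₂ w

ModuleComposed : Graph → Set
ModuleComposed G =
  Σ (Permutation′ (n G)) λ φ →
    ∀ u → 1 Data.Nat.≤ toℕ (φ ⟨$⟩ʳ u) →
      let S : Fin (n G) → Bool
          S w = Data.Nat._<ᵇ_ (toℕ (φ ⟨$⟩ʳ w)) (toℕ (φ ⟨$⟩ʳ u))
      in IsModuleIn G S (λ w → S w ∧ adj G u w)
  where import Data.Nat

module Submission where

-- Call a vertex v of a vertex set S modular if its neighbours in S agree on all other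
-- vertices of S, i.e. N(v) ∩ (S ∖ v) is a module of G[S ∖ v].  G is module-composed as
-- soon as every nonempty vertex set has a modular vertex: fill the positions from the last
-- one down, each time moving a modular vertex of the not yet fixed vertices into the current
-- position by a transposition (module Ordering).
--
-- Modular vertices exist by Seinsche's theorem (module Seinsche): in a P4-free graph every
-- vertex set with two vertices has a cut whose crossing pairs all have the same adjacency b,
-- i.e. it is disconnected (b = false) or co-disconnected (b = true) (module Cuts).  In the
-- disconnected case a modular vertex of one side is modular in S.  In the co-disconnected
-- case two induced 2K2's on opposite sides would form an induced co-2C4, so one side is
-- 2K2-free; there some vertex has all its neighbours adjacent to all its non-neighbours,
-- and such a vertex stays modular in S (module ModularVertices).

open import Defs renaming (sym to adj-sym; irrefl to adj-irrefl)
open import Data.Bool using (Bool; true; false; not; _∧_)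
open import Data.Bool.Properties using (T-≡; ¬-not; not-¬; not-involutive; ∧-conicalˡ; ∧-conicalʳ)
  renaming (_≟_ to _≟ᵇ_)
open import Data.Empty using (⊥; ⊥-elim)
open import Data.Fin using (Fin; toℕ; fromℕ<; _↑ˡ_)
open import Data.Fin.Patterns using (0F; 1F; 2F; 3F)
open import Data.Fin.Properties using (any?; all?; toℕ-injective; toℕ-fromℕ<; toℕ<n)
  renaming (_≟_ to _≟ᶠ_)
open import Data.Fin.Subset using (Subset; _∈_; _∉_; _⊆_; _∩_; ∁; ⁅_⁆; ∣_∣)
open import Data.Fin.Subset.Properties
  using (_∈?_; anySubset?; p⊂q⇒∣p∣<∣q∣; p∩q⊆p; p∩q⊆q; x∈p∩q⁺; x∈p∩q⁻;
         x∈∁p⇒x∉p; x∉p⇒x∈∁p; x∈p⇒x∉∁p; x∉∁p⇒x∈p;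
         x∈⁅x⁆; x∈⁅y⁆⇒x≡y; x≢y⇒x∉⁅y⁆; x∉⁅y⁆⇒x≢y)
open import Data.Fin.Permutation using (Permutation′; _⟨$⟩ʳ_; _∘ₚ_; id; inverseʳ)
  renaming (transpose to transposition)
open import Data.Fin.Permutation.Components using (transpose)
open import Data.Nat using (ℕ; zero; suc; _+_; _≤_; _<_; _<ᵇ_; z≤n; s≤s)
open import Data.Nat.Induction using (<-wellFounded)
open import Data.Nat.Properties
  using (<ᵇ⇒<; <⇒<ᵇ; _<?_; ≤-reflexive; <-trans; <-≤-trans; ≤-antisym; ≤∧≢⇒<; n≮n; m≤n+m;
         +-suc; +-identityʳ; n<1+n; ≤-pred)
open import Data.Product using (∃-syntax; _×_; _,_; proj₁; proj₂)
open import Data.Sum using (_⊎_; inj₁; inj₂)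
open import Data.Vec using (tabulate)
open import Data.Vec.Properties using (lookup∘tabulate; lookup⇒[]=; []=⇒lookup)
open import Function using (_∘_)
open import Function.Bundles using (Equivalence; Injection)
open import Function.Properties.Inverse using (↔⇒↣)
open import Induction.WellFounded using (Acc; acc)
open import Relation.Nullary using (¬_; Dec; yes; no; does)
open import Relation.Nullary.Decidable
  using (_×-dec_; _⊎-dec_; ¬?; _→-dec_; map′; toWitness; dec-true; dec-false; isYes≗does;
         decidable-stable)
open import Relation.Unary using (Decidable)
open import Relation.Binary.PropositionalEquality using (_≡_; _≢_; refl; cong; cong₂; subst; trans)
  renaming (sym to ≡-sym)

module _ {N : ℕ} where

  infixl 5 _∖_
  _∖_ : Subset N → Fin N → Subset N
  S ∖ u = S ∩ ∁ ⁅ u ⁆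

  ∈∖⁺ : ∀ {S x u} → x ∈ S → x ≢ u → x ∈ S ∖ u
  ∈∖⁺ x∈S x≢u = x∈p∩q⁺ (x∈S , x∉p⇒x∈∁p (x≢y⇒x∉⁅y⁆ x≢u))

  ∈∖⁻ : ∀ {S x u} → x ∈ S ∖ u → x ∈ S × x ≢ u
  ∈∖⁻ {S} {u = u} x∈S∖u with x∈p∩q⁻ S (∁ ⁅ u ⁆) x∈S∖u
  ... | x∈S , x∈∁u = x∈S , x∉⁅y⁆⇒x≢y (x∈∁p⇒x∉p x∈∁u)

  ∉∖ : ∀ {S u} → u ∉ S ∖ u
  ∉∖ u∈S∖u = proj₂ (∈∖⁻ u∈S∖u) refl

  select : {P : Fin N → Set} → Decidable P → Subset N
  select P? = tabulate (does ∘ P?)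

  ∈-select⁺ : ∀ {P : Fin N → Set} (P? : Decidable P) {x} → P x → x ∈ select P?
  ∈-select⁺ P? {x} px = lookup⇒[]= x _ (trans (lookup∘tabulate _ x) (dec-true (P? x) px))

  ∈-select⁻ : ∀ {P : Fin N → Set} (P? : Decidable P) {x} → x ∈ select P? → P x
  ∈-select⁻ P? {x} x∈ =
    toWitness {a? = P? x} (Equivalence.from T-≡
      (trans (isYes≗does (P? x)) (trans (≡-sym (lookup∘tabulate _ x)) ([]=⇒lookup x∈))))

  shrinks : ∀ {S T : Subset N} {y} → T ⊆ S → y ∈ S → y ∉ T → ∣ T ∣ < ∣ S ∣
  shrinks T⊆S y∈S y∉T = p⊂q⇒∣p∣<∣q∣ (T⊆S , _ , y∈S , y∉T)

<ᵇ-true⁻ : ∀ {a b} → (a <ᵇ b) ≡ true → a < b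
<ᵇ-true⁻ {a} {b} h = <ᵇ⇒< a b (Equivalence.from T-≡ h)

<ᵇ-true : ∀ {a b} → a < b → (a <ᵇ b) ≡ true
<ᵇ-true a<b = Equivalence.to T-≡ (<⇒<ᵇ a<b)

module _ {m : ℕ} where

  transpose-i : ∀ (i j : Fin m) → transpose i j i ≡ j
  transpose-i i j rewrite dec-true (i ≟ᶠ i) refl = refl

  transpose-j : ∀ (i j : Fin m) → transpose i j j ≡ i
  transpose-j i j with j ≟ᶠ i
  ... | yes j≡i = j≡i
  ... | no  _ rewrite dec-true (j ≟ᶠ j) refl = refl

  transpose-other : ∀ {i j a : Fin m} → a ≢ i → a ≢ j → transpose i j a ≡ a
  transpose-other {i} {j} {a} a≢i a≢j rewrite dec-false (a ≟ᶠ i) a≢i | dec-false (a ≟ᶠ j) a≢j = refl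

  transpose-below : ∀ {i j a : Fin m} {k} → toℕ i < k → toℕ j < k →
                    toℕ (transpose i j a) < k → toℕ a < k
  transpose-below {i} {j} {a} i<k j<k τa<k = by-cases (a ≟ᶠ i) (a ≟ᶠ j)
    where
    by-cases : Dec (a ≡ i) → Dec (a ≡ j) → toℕ a < _
    by-cases (yes refl) _          = i<k
    by-cases (no _)     (yes refl) = j<k
    by-cases (no a≢i)   (no a≢j)   = subst (λ b → toℕ b < _) (transpose-other a≢i a≢j) τa<k

≢not⇒≡ : ∀ {a b} → a ≢ not b → a ≡ b
≢not⇒≡ {b = b} a≢not-b = trans (¬-not a≢not-b) (not-involutive b)

Distinguishing : Graph → Set
Distinguishing H = ∀ x y → x ≡ y ⊎ adj H x y ≡ true ⊎ ∃[ z ] adj H x z ≢ adj H y z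

distinguishing? : ∀ H → Dec (Distinguishing H)
distinguishing? H = all? λ x → all? λ y →
  (x ≟ᶠ y) ⊎-dec (adj H x y ≟ᵇ true) ⊎-dec any? (λ z → ¬? (adj H x z ≟ᵇ adj H y z))

P4-distinguishing : Distinguishing P4
P4-distinguishing = toWitness {a? = distinguishing? P4} _

coTwoC4-distinguishing : Distinguishing coTwoC4
coTwoC4-distinguishing = toWitness {a? = distinguishing? coTwoC4} _

-- co-2C4 is the join of two copies of co-C4 (= 2K2), the complements of the two 4-cycles:
-- vertex x lies in copy cyc x at position pos x (checked by enumeration).
co-C4 : Fin 4 → Fin 4 → Bool
co-C4 i j = adj coTwoC4 (i ↑ˡ 4) (j ↑ˡ 4)

join : Bool → Bool → Fin 4 → Fin 4 → Bool
join false false = co-C4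
join true  true  = co-C4
join _     _     = λ _ _ → true

coTwoC4-join : ∀ x y → adj coTwoC4 x y ≡ join (cyc x) (cyc y) (pos x) (pos y)
coTwoC4-join = toWitness {a? = all? λ x → all? λ y →
  adj coTwoC4 x y ≟ᵇ join (cyc x) (cyc y) (pos x) (pos y)} _

module Patterns (G : Graph) where
  A : Fin (n G) → Fin (n G) → Bool
  A = adj G

  embed : ∀ H → Distinguishing H → (f : Fin (n H) → Fin (n G)) →
          (∀ x y → A (f x) (f y) ≡ adj H x y) → InducedSubgraph H G
  embed H dist f pres = f , injective , pres
    where
    injective : ∀ {x y} → f x ≡ f y → x ≡ y
    injective {x} {y} fx≡fy with dist x y
    ... | inj₁ x≡y = x≡y
    ... | inj₂ (inj₁ xy) with () ← trans (≡-sym xy) (trans (≡-sym (pres x y))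
                                    (trans (cong (A (f x)) (≡-sym fx≡fy)) (adj-irrefl G (f x))))
    ... | inj₂ (inj₂ (z , xz≢yz)) =
      ⊥-elim (xz≢yz (trans (≡-sym (pres x z)) (trans (cong (λ w → A w (f z)) fx≡fy) (pres y z))))

  quad : (a b c d : Fin (n G)) → Fin 4 → Fin (n G)
  quad a b c d 0F = a
  quad a b c d 1F = b
  quad a b c d 2F = c
  quad a b c d 3F = d

  quad-realises : (H : Fin 4 → Fin 4 → Bool) → (∀ i j → H i j ≡ H j i) → (∀ i → H i i ≡ false) →
    ∀ {a b c d} → A a b ≡ H 0F 1F → A a c ≡ H 0F 2F → A a d ≡ H 0F 3F →
    A b c ≡ H 1F 2F → A b d ≡ H 1F 3F → A c d ≡ H 2F 3F →
    ∀ i j → A (quad a b c d i) (quad a b c d j) ≡ H i j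
  quad-realises H H-sym H-irrefl {a} {b} {c} {d} ab ac ad bc bd cd = realise
    where
    mirror : ∀ {x y i j} → A x y ≡ H i j → A y x ≡ H j i
    mirror {i = i} {j} e = trans (adj-sym G _ _) (trans e (H-sym i j))
    diagonal : ∀ x i → A x x ≡ H i i
    diagonal x i = trans (adj-irrefl G x) (≡-sym (H-irrefl i))
    realise : ∀ i j → A (quad a b c d i) (quad a b c d j) ≡ H i j
    realise 0F 0F = diagonal a 0F
    realise 0F 1F = ab
    realise 0F 2F = ac
    realise 0F 3F = ad
    realise 1F 0F = mirror ab
    realise 1F 1F = diagonal b 1F
    realise 1F 2F = bc
    realise 1F 3F = bd
    realise 2F 0F = mirror ac
    realise 2F 1F = mirror bc
    realise 2F 2F = diagonal c 2F
    realise 2F 3F = cd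
    realise 3F 0F = mirror ad
    realise 3F 1F = mirror bd
    realise 3F 2F = mirror cd
    realise 3F 3F = diagonal d 3F

  induced-P4 : Free P4 G → ∀ {a b c d} →
    A a b ≡ true → A a c ≡ false → A a d ≡ false → A b c ≡ true → A b d ≡ false → A c d ≡ true → ⊥
  induced-P4 free ab ac ad bc bd cd = free (embed P4 P4-distinguishing (quad _ _ _ _)
    (quad-realises (adj P4) (adj-sym P4) (adj-irrefl P4) ab ac ad bc bd cd))

  -- p induces a 2K2, with edges p 0 - p 2 and p 1 - p 3.
  Is2K2 : (Fin 4 → Fin (n G)) → Set
  Is2K2 p = ∀ i j → A (p i) (p j) ≡ co-C4 i j

  two-edges-2K2 : ∀ {a a′ c c′} → A a a′ ≡ true → A c c′ ≡ true →
    A a c ≡ false → A a c′ ≡ false → A c a′ ≡ false → A a′ c′ ≡ false → Is2K2 (quad a c a′ c′)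
  two-edges-2K2 aa′ cc′ ac ac′ ca′ a′c′ =
    quad-realises co-C4 (λ i j → adj-sym coTwoC4 (i ↑ˡ 4) (j ↑ˡ 4)) (λ i → adj-irrefl coTwoC4 (i ↑ˡ 4))
      ac aa′ ac′ ca′ cc′ a′c′

  Has2K2 : Subset (n G) → Set
  Has2K2 S = ∃[ a ] ∃[ b ] ∃[ c ] ∃[ d ] (∀ i → quad a b c d i ∈ S) × Is2K2 (quad a b c d)

  has2K2? : ∀ S → Dec (Has2K2 S)
  has2K2? S = any? λ a → any? λ b → any? λ c → any? λ d →
    all? (λ i → quad a b c d i ∈? S) ×-dec
    all? (λ i → all? λ j → A (quad a b c d i) (quad a b c d j) ≟ᵇ co-C4 i j)

  has2K2-⊆ : ∀ {S T} → T ⊆ S → Has2K2 T → Has2K2 S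
  has2K2-⊆ T⊆S (a , b , c , d , in-T , is-2K2) = a , b , c , d , T⊆S ∘ in-T , is-2K2

  joined-2K2s : Free coTwoC4 G → ∀ {p q} → Is2K2 p → Is2K2 q → (∀ i j → A (p i) (q j) ≡ true) → ⊥
  joined-2K2s free {p} {q} p-2K2 q-2K2 pq = free (embed coTwoC4 coTwoC4-distinguishing f realise)
    where
    copy : Bool → Fin 4 → Fin (n G)
    copy false = p
    copy true  = q
    f : Fin 8 → Fin (n G)
    f x = copy (cyc x) (pos x)
    glue : ∀ c c′ i j → A (copy c i) (copy c′ j) ≡ join c c′ i j
    glue false false = p-2K2
    glue true  true  = q-2K2
    glue false true  = pq
    glue true  false i j = trans (adj-sym G _ _) (pq j i)
    realise : ∀ x y → A (f x) (f y) ≡ adj coTwoC4 x y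
    realise x y = trans (glue (cyc x) (cyc y) (pos x) (pos y)) (≡-sym (coTwoC4-join x y))

module Cuts (G : Graph) where
  A : Fin (n G) → Fin (n G) → Bool
  A = adj G

  -- C cuts S into two nonempty sides with every pair across the cut of adjacency b:
  -- for b = false, G[S] is disconnected; for b = true, its complement is.
  record Cut (b : Bool) (S C : Subset (n G)) : Set where
    field
      inner  : ∃[ x ] x ∈ S × x ∈ C
      outer  : ∃[ y ] y ∈ S × y ∉ C
      across : ∀ {x y} → x ∈ S → y ∈ S → x ∈ C → y ∉ C → A x y ≡ b
  open Cut public

  NoCut : Bool → Subset (n G) → Set
  NoCut b S = ¬ (∃[ C ] Cut b S C)

  cut? : ∀ b S → Dec (∃[ C ] Cut b S C)
  cut? b S = anySubset? λ C → map′ (λ (i , o , a) → record { inner = i ; outer = o ; across = a _ _ })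
    (λ c → inner c , outer c , λ x y → across c)
    (any? (λ x → x ∈? S ×-dec x ∈? C) ×-dec any? (λ y → y ∈? S ×-dec ¬? (y ∈? C)) ×-dec
     all? λ x → all? λ y → x ∈? S →-dec y ∈? S →-dec x ∈? C →-dec ¬? (y ∈? C) →-dec A x y ≟ᵇ b)

  cut-∁ : ∀ {b S C} → Cut b S C → Cut b S (∁ C)
  cut-∁ cut = record
    { inner  = let (y , y∈S , y∉C) = outer cut in y , y∈S , x∉p⇒x∈∁p y∉C
    ; outer  = let (x , x∈S , x∈C) = inner cut in x , x∈S , x∈p⇒x∉∁p x∈C
    ; across = λ x∈S y∈S x∈∁C y∉∁C →
        trans (adj-sym G _ _) (across cut y∈S x∈S (x∉∁p⇒x∈p y∉∁C) (x∈∁p⇒x∉p x∈∁C))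
    }

  cut-side : ∀ {b S C z} → Cut b S C → z ∈ S → ∃[ D ] z ∈ D × Cut b S D
  cut-side {C = C} {z} cut z∈S with z ∈? C
  ... | yes z∈C = C , z∈C , cut
  ... | no  z∉C = ∁ C , x∉p⇒x∈∁p z∉C , cut-∁ cut

  side-smaller : ∀ {b S C} → Cut b S C → ∣ S ∩ C ∣ < ∣ S ∣
  side-smaller {S = S} {C} cut with outer cut
  ... | y , y∈S , y∉C = shrinks (p∩q⊆p S C) y∈S (y∉C ∘ p∩q⊆q S C)

  side-vertex : ∀ {b S C} → Cut b S C → ∃[ x ] x ∈ S ∩ C
  side-vertex cut with inner cut
  ... | x , x∈S , x∈C = x , x∈p∩q⁺ (x∈S , x∈C)

  cut-refine : ∀ {b S K D} → Cut b S K → Cut b (S ∩ K) D → Cut b S (K ∩ D)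
  cut-refine {S = S} {K} {D} cutK cutD = record
    { inner  = let (x , x∈S∩K , x∈D) = inner cutD; (x∈S , x∈K) = x∈p∩q⁻ S K x∈S∩K
               in x , x∈S , x∈p∩q⁺ (x∈K , x∈D)
    ; outer  = let (y , y∈S , y∉K) = outer cutK in y , y∈S , y∉K ∘ p∩q⊆p K D
    ; across = crossing
    }
    where
    crossing : ∀ {x y} → x ∈ S → y ∈ S → x ∈ K ∩ D → y ∉ K ∩ D → A x y ≡ _
    crossing {y = y} x∈S y∈S x∈K∩D y∉K∩D with x∈p∩q⁻ K D x∈K∩D | y ∈? K
    ... | x∈K , x∈D | yes y∈K = across cutD (x∈p∩q⁺ (x∈S , x∈K)) (x∈p∩q⁺ (y∈S , y∈K)) x∈D
                                   (λ y∈D → y∉K∩D (x∈p∩q⁺ (y∈K , y∈D)))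
    ... | x∈K , _    | no  y∉K = across cutK x∈S y∈S x∈K y∉K

  -- Refining as long as possible: every z ∈ S lies on a side K of a b-cut of S
  -- such that S ∩ K has no further b-cut (S ∩ K is the b-component of z).
  component : ∀ {b S C z} → Cut b S C → z ∈ S → ∃[ K ] z ∈ K × Cut b S K × NoCut b (S ∩ K)
  component {b} {S} {z = z} cutC z∈S with cut-side cutC z∈S
  ... | K , z∈K , cutK = refine K (<-wellFounded _) z∈K cutK
    where
    refine : ∀ K → Acc _<_ ∣ S ∩ K ∣ → z ∈ K → Cut b S K →
             ∃[ K′ ] z ∈ K′ × Cut b S K′ × NoCut b (S ∩ K′)
    refine K (acc smaller) z∈K cutK with cut? b (S ∩ K)
    ... | no  no-cut = K , z∈K , cutK , no-cut
    ... | yes (D , cutD) with cut-side cutD (x∈p∩q⁺ (z∈S , z∈K))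
    ... | D′ , z∈D′ , cutD′ =
      refine (K ∩ D′) (smaller fewer) (x∈p∩q⁺ (z∈K , z∈D′)) (cut-refine cutK cutD′)
      where
      fewer : ∣ S ∩ (K ∩ D′) ∣ < ∣ S ∩ K ∣
      fewer with outer cutD′
      ... | y , y∈S∩K , y∉D′ = shrinks
        (λ x∈ → x∈p∩q⁺ (p∩q⊆p S _ x∈ , p∩q⊆p K D′ (p∩q⊆q S _ x∈)))
        y∈S∩K
        (y∉D′ ∘ p∩q⊆q K D′ ∘ p∩q⊆q S _)

  isolate : ∀ {b S u} → u ∈ S → ∃[ x ] x ∈ S ∖ u → (∀ {x} → x ∈ S ∖ u → A u x ≡ b) → Cut b S ⁅ u ⁆
  isolate {u = u} u∈S (x , x∈S∖u) uniform = record
    { inner  = u , u∈S , x∈⁅x⁆ u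
    ; outer  = x , proj₁ (∈∖⁻ x∈S∖u) , x≢y⇒x∉⁅y⁆ (proj₂ (∈∖⁻ x∈S∖u))
    ; across = λ {y = y} x∈S y∈S x∈u y∉u → subst (λ w → A w y ≡ _) (≡-sym (x∈⁅y⁆⇒x≡y u x∈u))
                 (uniform (∈∖⁺ y∈S (x∉⁅y⁆⇒x≢y y∉u)))
    }

  absorb : ∀ {b S u K} → u ∈ S → Cut b (S ∖ u) K → (∀ {x} → x ∈ (S ∖ u) ∩ K → A u x ≡ b) →
           Cut b S ((S ∖ u) ∩ K)
  absorb {b} {S} {u} {K} u∈S cutK uniform = record
    { inner  = let (x , x∈S∖u , x∈K) = inner cutK in x , proj₁ (∈∖⁻ x∈S∖u) , x∈p∩q⁺ (x∈S∖u , x∈K)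
    ; outer  = u , u∈S , ∉∖ ∘ p∩q⊆p (S ∖ u) K
    ; across = crossing
    }
    where
    crossing : ∀ {x y} → x ∈ S → y ∈ S → x ∈ (S ∖ u) ∩ K → y ∉ (S ∖ u) ∩ K → A x y ≡ b
    crossing {x} {y} x∈S y∈S x∈S∖u∩K y∉S∖u∩K with y ≟ᶠ u | x∈p∩q⁻ (S ∖ u) K x∈S∖u∩K
    ... | yes refl | _ = trans (adj-sym G x u) (uniform x∈S∖u∩K)
    ... | no y≢u | x∈S∖u , x∈K =
      across cutK x∈S∖u (∈∖⁺ y∈S y≢u) x∈K (λ y∈K → y∉S∖u∩K (x∈p∩q⁺ (∈∖⁺ y∈S y≢u , y∈K)))

  uniform? : ∀ b u T → (∀ {x} → x ∈ T → A u x ≡ b) ⊎ ∃[ c ] c ∈ T × A u c ≡ not b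
  uniform? b u T with any? (λ c → c ∈? T ×-dec A u c ≟ᵇ not b)
  ... | yes found = inj₂ found
  ... | no  none  = inj₁ λ {x} x∈T → ≢not⇒≡ λ e → none (x , x∈T , e)

  -- Without a b-cut of S, the vertices of S at adjacency b from u cannot be separated from
  -- the others: some such x and some y at adjacency not b from u have adjacency not b.
  bridge : ∀ {b S u z c} → NoCut b S → z ∈ S → A u z ≡ b → c ∈ S → A u c ≡ not b →
           ∃[ x ] ∃[ y ] x ∈ S × y ∈ S × A u x ≡ b × A u y ≡ not b × A x y ≡ not b
  bridge {b} {S} {u} {z} {c} no-cut z∈S uz c∈S uc with any? (λ x → any? λ y →
    x ∈? S ×-dec y ∈? S ×-dec A u x ≟ᵇ b ×-dec A u y ≟ᵇ not b ×-dec A x y ≟ᵇ not b)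
  ... | yes found = found
  ... | no  none  = ⊥-elim (no-cut (Nb , record
    { inner  = z , z∈S , ∈-select⁺ b-from-u uz
    ; outer  = c , c∈S , λ c∈Nb → not-¬ (∈-select⁻ b-from-u c∈Nb) uc
    ; across = λ {x} {y} x∈S y∈S x∈Nb y∉Nb → ≢not⇒≡ λ e → none
        (x , y , x∈S , y∈S , ∈-select⁻ b-from-u x∈Nb , ¬-not (y∉Nb ∘ ∈-select⁺ b-from-u) , e)
    }))
    where
    b-from-u : ∀ x → Dec (A u x ≡ b)
    b-from-u x = A u x ≟ᵇ b
    Nb : Subset (n G)
    Nb = select b-from-u

-- Seinsche's theorem: in a P4-free graph every vertex set with at least two vertices
-- is disconnected or co-disconnected.
module Seinsche (G : Graph) (p4-free : Free P4 G) where
  open Patterns G using (induced-P4)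
  open Cuts G

  -- These adjacencies among u, x, y, d describe an induced P4
  -- (the path x - y - u - d if b = false, the path u - x - d - y if b = true).
  no-P4 : ∀ b {u x y d} → A u x ≡ b → A u y ≡ not b → A x y ≡ not b →
          A u d ≡ not b → A x d ≡ b → A y d ≡ b → ⊥
  no-P4 false {u} {x} {y} ux uy xy ud xd yd =
    induced-P4 p4-free xy (trans (adj-sym G x u) ux) xd (trans (adj-sym G y u) uy) yd ud
  no-P4 true {u} {x} {y} {d} ux uy xy ud xd yd =
    induced-P4 p4-free ux ud uy xd xy (trans (adj-sym G d y) yd)

  -- Adding a vertex u to a set with a cut gives a set with a cut. Otherwise u meets
  -- both the b-component K of a vertex z and the rest of S ∖ u at adjacency not b,
  -- and a bridge inside K together with u and a vertex d outside K induce a P4.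
  extend : ∀ {b S u C} → u ∈ S → Cut b (S ∖ u) C → ∃[ b′ ] ∃[ C′ ] Cut b′ S C′
  extend {b} {S} {u} u∈S cutC with uniform? (not b) u (S ∖ u)
  ... | inj₁ u-not-b = not b , ⁅ u ⁆ , isolate u∈S (let (x , x∈ , _) = inner cutC in x , x∈) u-not-b
  ... | inj₂ (z , z∈S∖u , uz) with component cutC z∈S∖u
  ... | K , z∈K , cutK , no-cut with uniform? b u ((S ∖ u) ∩ K) | uniform? b u ((S ∖ u) ∩ ∁ K)
  ... | inj₁ u-b | _        = b , _ , absorb u∈S cutK u-b
  ... | inj₂ _   | inj₁ u-b = b , _ , absorb u∈S (cut-∁ cutK) u-b
  ... | inj₂ (c , c∈K , uc) | inj₂ (d , d∈∁K , ud)
    with bridge no-cut (x∈p∩q⁺ (z∈S∖u , z∈K)) (trans uz (not-involutive b)) c∈K uc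
  ... | x , y , x∈K , y∈K , ux , uy , xy = ⊥-elim (no-P4 b ux uy xy ud (beyond x∈K) (beyond y∈K))
    where
    beyond : ∀ {x} → x ∈ (S ∖ u) ∩ K → A x d ≡ b
    beyond x∈ = across cutK (p∩q⊆p (S ∖ u) K x∈) (p∩q⊆p (S ∖ u) (∁ K) d∈∁K)
                            (p∩q⊆q (S ∖ u) K x∈) (x∈∁p⇒x∉p (p∩q⊆q (S ∖ u) (∁ K) d∈∁K))

  seinsche : ∀ {S p q} → p ∈ S → q ∈ S → p ≢ q → ∃[ b ] ∃[ C ] Cut b S C
  seinsche {S} = by-size S (<-wellFounded _)
    where
    by-size : ∀ S → Acc _<_ ∣ S ∣ → ∀ {p q} → p ∈ S → q ∈ S → p ≢ q → ∃[ b ] ∃[ C ] Cut b S C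
    by-size S (acc smaller) {p} {q} p∈S q∈S p≢q
      with any? (λ r → r ∈? S ∖ p ×-dec ¬? (r ≟ᶠ q))
    ... | no only-q = A p q , ⁅ p ⁆ , isolate p∈S (q , q∈S∖p) λ {x} x∈S∖p →
          cong (A p) (decidable-stable (x ≟ᶠ q) λ x≢q → only-q (x , x∈S∖p , x≢q))
      where
      q∈S∖p : q ∈ S ∖ p
      q∈S∖p = ∈∖⁺ q∈S (p≢q ∘ ≡-sym)
    ... | yes (r , r∈S∖p , r≢q)
      with by-size (S ∖ p) (smaller (shrinks (proj₁ ∘ ∈∖⁻) p∈S ∉∖))
                   (∈∖⁺ q∈S (p≢q ∘ ≡-sym)) r∈S∖p (r≢q ∘ ≡-sym)
    ... | b , C , cutC = extend p∈S cutC

  singleton-or-cut : ∀ {S p} → p ∈ S → (∀ {w} → w ∈ S → w ≡ p) ⊎ ∃[ b ] ∃[ C ] Cut b S C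
  singleton-or-cut {S} {p} p∈S with any? (λ q → q ∈? S ×-dec ¬? (q ≟ᶠ p))
  ... | yes (q , q∈S , q≢p) = inj₂ (seinsche p∈S q∈S (q≢p ∘ ≡-sym))
  ... | no  none = inj₁ λ {w} w∈S → decidable-stable (w ≟ᶠ p) λ w≢p → none (w , w∈S , w≢p)

module Modularity (G : Graph) where
  open Cuts G

  Modular : Subset (n G) → Fin (n G) → Set
  Modular S v = ∀ {x y w} → x ∈ S → y ∈ S → w ∈ S → w ≢ v →
                A v x ≡ true → A v y ≡ true → A v w ≡ false → A x w ≡ A y w

  Joined : Subset (n G) → Fin (n G) → Set
  Joined S v = ∀ {x w} → x ∈ S → w ∈ S → w ≢ v → A v x ≡ true → A v w ≡ false → A x w ≡ true

  joined⇒modular : ∀ {S v} → Joined S v → Modular S v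
  joined⇒modular joined x∈S y∈S w∈S w≢v vx vy vw =
    trans (joined x∈S w∈S w≢v vx vw) (≡-sym (joined y∈S w∈S w≢v vy vw))

  same-side : ∀ {S C v x} → Cut false S C → v ∈ S → v ∈ C → x ∈ S → A v x ≡ true → x ∈ C
  same-side {C = C} {x = x} cut v∈S v∈C x∈S vx with x ∈? C
  ... | yes x∈C = x∈C
  ... | no  x∉C with () ← trans (≡-sym vx) (across cut v∈S x∈S v∈C x∉C)

  modular-lift : ∀ {S C v} → Cut false S C → v ∈ S ∩ C → Modular (S ∩ C) v → Modular S v
  modular-lift {S} {C} cut v∈S∩C modular {x} {y} {w} x∈S y∈S w∈S w≢v vx vy vw
    with same-side cut (p∩q⊆p S C v∈S∩C) (p∩q⊆q S C v∈S∩C) x∈S vx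
       | same-side cut (p∩q⊆p S C v∈S∩C) (p∩q⊆q S C v∈S∩C) y∈S vy | w ∈? C
  ... | x∈C | y∈C | yes w∈C =
    modular (x∈p∩q⁺ (x∈S , x∈C)) (x∈p∩q⁺ (y∈S , y∈C)) (x∈p∩q⁺ (w∈S , w∈C)) w≢v vx vy vw
  ... | x∈C | y∈C | no  w∉C =
    trans (across cut x∈S w∈S x∈C w∉C) (≡-sym (across cut y∈S w∈S y∈C w∉C))

  joined-lift : ∀ {S C v} → Cut true S C → v ∈ S ∩ C → Joined (S ∩ C) v → Joined S v
  joined-lift {S} {C} cut v∈S∩C joined {x} {w} x∈S w∈S w≢v vx vw with w ∈? C | x ∈? C
  ... | no  w∉C | _ with () ← trans (≡-sym vw)
                                (across cut (p∩q⊆p S C v∈S∩C) w∈S (p∩q⊆q S C v∈S∩C) w∉C)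
  ... | yes w∈C | yes x∈C = joined (x∈p∩q⁺ (x∈S , x∈C)) (x∈p∩q⁺ (w∈S , w∈C)) w≢v vx vw
  ... | yes w∈C | no  x∉C = trans (adj-sym G x w) (across cut w∈S x∈S w∈C x∉C)

module ModularVertices (G : Graph) (p4-free : Free P4 G) (co2C4-free : Free coTwoC4 G) where
  open Patterns G using (quad; Has2K2; has2K2?; has2K2-⊆; two-edges-2K2; joined-2K2s)
  open Cuts G
  open Seinsche G p4-free
  open Modularity G

  HasEdge : Subset (n G) → Set
  HasEdge S = ∃[ a ] ∃[ a′ ] a ∈ S × a′ ∈ S × A a a′ ≡ true

  hasEdge? : ∀ S → Dec (HasEdge S)
  hasEdge? S = any? λ a → any? λ a′ → a ∈? S ×-dec a′ ∈? S ×-dec A a a′ ≟ᵇ true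

  edgeless-side : ∀ {S C} → Cut false S C → ¬ HasEdge (S ∩ C) → ∃[ v ] v ∈ S × Joined S v
  edgeless-side cut no-edge with inner cut
  ... | v , v∈S , v∈C = v , v∈S , λ {x} x∈S _ _ vx _ → ⊥-elim (no-edge
        (v , x , x∈p∩q⁺ (v∈S , v∈C) , x∈p∩q⁺ (x∈S , same-side cut v∈S v∈C x∈S vx) , vx))

  -- A vertex set without induced 2K2 has a joined vertex: in the co-disconnected case
  -- recurse into a side; in the disconnected case one side is edgeless.
  joined-vertex : ∀ {S p} → ¬ Has2K2 S → p ∈ S → ∃[ v ] v ∈ S × Joined S v
  joined-vertex {S} = by-size S (<-wellFounded _)
    where
    by-size : ∀ S → Acc _<_ ∣ S ∣ → ∀ {p} → ¬ Has2K2 S → p ∈ S → ∃[ v ] v ∈ S × Joined S v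
    by-size S _ {p} no-2K2 p∈S with singleton-or-cut p∈S
    ... | inj₁ only-p = p , p∈S , λ _ w∈S w≢p _ _ → ⊥-elim (w≢p (only-p w∈S))
    ... | inj₂ (false , C , cut) with hasEdge? (S ∩ C) | hasEdge? (S ∩ ∁ C)
    ... | no  no-edge | _ = edgeless-side cut no-edge
    ... | yes _ | no  no-edge = edgeless-side (cut-∁ cut) no-edge
    ... | yes (a , a′ , a∈ , a′∈ , aa′) | yes (c , c′ , c∈ , c′∈ , cc′) = ⊥-elim (no-2K2
          (a , c , a′ , c′ , in-S , two-edges-2K2 aa′ cc′ (apart a∈ c∈) (apart a∈ c′∈)
                                    (trans (adj-sym G c a′) (apart a′∈ c∈)) (apart a′∈ c′∈)))
      where
      apart : ∀ {x y} → x ∈ S ∩ C → y ∈ S ∩ ∁ C → A x y ≡ false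
      apart x∈ y∈ with x∈p∩q⁻ S C x∈ | x∈p∩q⁻ S (∁ C) y∈
      ... | x∈S , x∈C | y∈S , y∈∁C = across cut x∈S y∈S x∈C (x∈∁p⇒x∉p y∈∁C)
      in-S : ∀ i → quad a c a′ c′ i ∈ S
      in-S 0F = p∩q⊆p S C a∈
      in-S 1F = p∩q⊆p S (∁ C) c∈
      in-S 2F = p∩q⊆p S C a′∈
      in-S 3F = p∩q⊆p S (∁ C) c′∈
    by-size S (acc smaller) no-2K2 p∈S | inj₂ (true , C , cut) with side-vertex cut
    ... | x , x∈S∩C
      with by-size (S ∩ C) (smaller (side-smaller cut)) (no-2K2 ∘ has2K2-⊆ (p∩q⊆p S C)) x∈S∩C
    ... | v , v∈S∩C , joined = v , p∩q⊆p S C v∈S∩C , joined-lift cut v∈S∩C joined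

  joined-side : ∀ {S C} → Cut true S C → ¬ Has2K2 (S ∩ C) → ∃[ v ] v ∈ S × Modular S v
  joined-side {S} {C} cut no-2K2 with joined-vertex no-2K2 (proj₂ (side-vertex cut))
  ... | v , v∈S∩C , joined = v , p∩q⊆p S C v∈S∩C , joined⇒modular (joined-lift cut v∈S∩C joined)

  -- Disconnected: recurse into a side. Co-disconnected: one side is 2K2-free, since
  -- two 2K2's on opposite sides would be joined into an induced co-2C4.
  modular-vertex : ∀ {S p} → p ∈ S → ∃[ v ] v ∈ S × Modular S v
  modular-vertex {S} = by-size S (<-wellFounded _)
    where
    by-size : ∀ S → Acc _<_ ∣ S ∣ → ∀ {p} → p ∈ S → ∃[ v ] v ∈ S × Modular S v
    by-size S _ {p} p∈S with singleton-or-cut p∈S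
    ... | inj₁ only-p = p , p∈S , λ _ _ w∈S w≢p _ _ _ → ⊥-elim (w≢p (only-p w∈S))
    ... | inj₂ (true , C , cut) with has2K2? (S ∩ C) | has2K2? (S ∩ ∁ C)
    ... | no  none | _ = joined-side cut none
    ... | yes _ | no  none = joined-side (cut-∁ cut) none
    ... | yes (_ , _ , _ , _ , p∈ , p-2K2) | yes (_ , _ , _ , _ , q∈ , q-2K2) =
          ⊥-elim (joined-2K2s co2C4-free p-2K2 q-2K2 λ i j →
            across cut (p∩q⊆p S C (p∈ i)) (p∩q⊆p S (∁ C) (q∈ j))
                       (p∩q⊆q S C (p∈ i)) (x∈∁p⇒x∉p (p∩q⊆q S (∁ C) (q∈ j))))
    by-size S (acc smaller) p∈S | inj₂ (false , C , cut)
      with by-size (S ∩ C) (smaller (side-smaller cut)) (proj₂ (side-vertex cut))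
    ... | v , v∈S∩C , modular = v , p∩q⊆p S C v∈S∩C , modular-lift cut v∈S∩C modular

module Ordering (G : Graph)
  (modular-vertex : ∀ {S : Subset (n G)} {p} → p ∈ S → ∃[ v ] v ∈ S × Modularity.Modular G S v) where
  open Modularity G

  Prefix : Permutation′ (n G) → ℕ → Fin (n G) → Bool
  Prefix σ m w = toℕ (σ ⟨$⟩ʳ w) <ᵇ m

  NbhdModule : (Fin (n G) → Bool) → Fin (n G) → Set
  NbhdModule T u = IsModuleIn G T (λ w → T w ∧ adj G u w)

  Placed : Permutation′ (n G) → Fin (n G) → Set
  Placed σ u = NbhdModule (Prefix σ (toℕ (σ ⟨$⟩ʳ u))) u

  PlacedFrom : ℕ → Permutation′ (n G) → Set
  PlacedFrom k σ = ∀ u → k ≤ toℕ (σ ⟨$⟩ʳ u) → Placed σ u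

  nbhdModule-⊆ : ∀ {S T u} → (∀ {w} → T w ≡ true → S w ≡ true) → NbhdModule S u → NbhdModule T u
  nbhdModule-⊆ {S} {T} {u} T⊆S module-S v₁ v₂ w v₁∈M v₂∈M w∈T w∉M =
    module-S v₁ v₂ w (enlarge v₁∈M) (enlarge v₂∈M) (T⊆S w∈T)
      (subst (λ s → s ∧ adj G u w ≡ false) (≡-sym (T⊆S w∈T))
             (subst (λ t → t ∧ adj G u w ≡ false) w∈T w∉M))
    where
    enlarge : ∀ {x} → T x ∧ adj G u x ≡ true → S x ∧ adj G u x ≡ true
    enlarge h = cong₂ _∧_ (T⊆S (∧-conicalˡ _ _ h)) (∧-conicalʳ _ _ h)

  modular⇒nbhdModule : ∀ {S T v} → Modular S v → (∀ {w} → T w ≡ true → w ∈ S × w ≢ v) →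
                       NbhdModule T v
  modular⇒nbhdModule {v = v} modular T⊆S∖v v₁ v₂ w v₁∈M v₂∈M w∈T w∉M =
    modular (proj₁ (T⊆S∖v (∧-conicalˡ _ _ v₁∈M))) (proj₁ (T⊆S∖v (∧-conicalˡ _ _ v₂∈M)))
            (proj₁ (T⊆S∖v w∈T)) (proj₂ (T⊆S∖v w∈T))
            (∧-conicalʳ _ _ v₁∈M) (∧-conicalʳ _ _ v₂∈M)
            (subst (λ t → t ∧ adj G v w ≡ false) w∈T w∉M)

  module _ {k : ℕ} {σ : Permutation′ (n G)} (k<n : k < n G) where
    i : Fin (n G)
    i = fromℕ< k<n

    toℕ-i : toℕ i ≡ k
    toℕ-i = toℕ-fromℕ< k<n

    at-most-k : ∀ w → Dec (toℕ (σ ⟨$⟩ʳ w) < suc k)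
    at-most-k w = toℕ (σ ⟨$⟩ʳ w) <? suc k

    i<1+k : toℕ i < suc k
    i<1+k = s≤s (≤-reflexive toℕ-i)

    -- Moving a modular vertex v of the positions ≤ k to position k by a transposition
    -- keeps every vertex at a position > k in place.
    step : PlacedFrom (suc k) σ → ∃[ σ′ ] PlacedFrom k σ′
    step placed with modular-vertex {select at-most-k}
                       (∈-select⁺ at-most-k (subst (λ a → toℕ a < suc k) (≡-sym (inverseʳ σ)) i<1+k))
    ... | v , v∈R , modular = σ ∘ₚ transposition i j , placed′
      where
      j : Fin (n G)
      j = σ ⟨$⟩ʳ v
      τ : Fin (n G) → Fin (n G)
      τ = transpose i j
      j<1+k : toℕ j < suc k
      j<1+k = ∈-select⁻ at-most-k v∈R

      v-at-k : toℕ (τ j) ≡ k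
      v-at-k = trans (cong toℕ (transpose-j i j)) toℕ-i

      untouched : ∀ {u} → u ≢ v → k ≤ toℕ (τ (σ ⟨$⟩ʳ u)) →
                  τ (σ ⟨$⟩ʳ u) ≡ σ ⟨$⟩ʳ u × k < toℕ (σ ⟨$⟩ʳ u)
      untouched {u} u≢v k≤τσu = by-cases (σ ⟨$⟩ʳ u ≟ᶠ i) (σ ⟨$⟩ʳ u ≟ᶠ j)
        where
        σ-injective : ∀ {a b} → σ ⟨$⟩ʳ a ≡ σ ⟨$⟩ʳ b → a ≡ b
        σ-injective = Injection.injective (↔⇒↣ σ)
        by-cases : Dec (σ ⟨$⟩ʳ u ≡ i) → Dec (σ ⟨$⟩ʳ u ≡ j) →
                   τ (σ ⟨$⟩ʳ u) ≡ σ ⟨$⟩ʳ u × k < toℕ (σ ⟨$⟩ʳ u)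
        by-cases _ (yes σu≡j) = ⊥-elim (u≢v (σ-injective σu≡j))
        by-cases (yes σu≡i) (no _) = ⊥-elim (u≢v (σ-injective (trans σu≡i (≡-sym j≡i))))
          where
          k≤j : k ≤ toℕ j
          k≤j = subst (λ a → k ≤ toℕ a) (trans (cong τ σu≡i) (transpose-i i j)) k≤τσu
          j≡i : j ≡ i
          j≡i = toℕ-injective (trans (≤-antisym (≤-pred j<1+k) k≤j) (≡-sym toℕ-i))
        by-cases (no σu≢i) (no σu≢j) =
          fixed , ≤∧≢⇒< (subst (λ a → k ≤ toℕ a) fixed k≤τσu)
                        (λ k≡σu → σu≢i (toℕ-injective (trans (≡-sym k≡σu) (≡-sym toℕ-i))))
          where
          fixed : τ (σ ⟨$⟩ʳ u) ≡ σ ⟨$⟩ʳ u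
          fixed = transpose-other σu≢i σu≢j

      placed′ : PlacedFrom k (σ ∘ₚ transposition i j)
      placed′ u k≤ with u ≟ᶠ v
      ... | yes refl = modular⇒nbhdModule modular earlier
        where
        earlier : ∀ {w} → Prefix (σ ∘ₚ transposition i j) (toℕ (τ j)) w ≡ true →
                  w ∈ select at-most-k × w ≢ u
        earlier {w} h =
          ∈-select⁺ at-most-k (transpose-below i<1+k j<1+k
            (<-trans (subst (toℕ (τ (σ ⟨$⟩ʳ w)) <_) v-at-k (<ᵇ-true⁻ h)) (n<1+n k)))
          , λ { refl → n≮n _ (<ᵇ-true⁻ {toℕ (τ j)} h) }
      ... | no u≢v with untouched u≢v k≤
      ... | fixed , k<σu = nbhdModule-⊆ earlier (placed u k<σu)
        where
        earlier : ∀ {w} → Prefix (σ ∘ₚ transposition i j) (toℕ (τ (σ ⟨$⟩ʳ u))) w ≡ true →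
                  Prefix σ (toℕ (σ ⟨$⟩ʳ u)) w ≡ true
        earlier h = <ᵇ-true (transpose-below (<-≤-trans i<1+k k<σu) (<-≤-trans j<1+k k<σu)
                      (subst (λ a → _ < toℕ a) fixed (<ᵇ-true⁻ h)))

  placed-from : ∀ d k → d + k ≡ n G → ∃[ σ ] PlacedFrom k σ
  placed-from zero    k refl = id , λ u n≤u → ⊥-elim (n≮n _ (<-≤-trans (toℕ<n u) n≤u))
  placed-from (suc d) k d+k≡n with placed-from d (suc k) (trans (+-suc d k) d+k≡n)
  ... | σ , placed = step {σ = σ} k<n placed
    where
    k<n : k < n G
    k<n = subst (suc k ≤_) (trans (+-suc d k) d+k≡n) (m≤n+m (suc k) d)

  moduleComposed : ModuleComposed G
  moduleComposed with placed-from (n G) 0 (+-identityʳ (n G))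
  ... | σ , placed = σ , λ u _ → placed u z≤n

corollary1 : (G : Graph) → Free coTwoC4 G → Free P4 G → ModuleComposed G
corollary1 G co2C4-free p4-free = Ordering.moduleComposed G modular-vertex
  where open ModularVertices G p4-free co2C4-free using (modular-vertex)
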